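{- Let $n,k,\ell$ be positive integers with $0<k<\ell<\ell^2\le n$. Then $\varphi(n-4)<\Gamma$, where $\varphi$ and $\Gamma$ are as defined in the context.
   Context: For fixed $n,k,\ell$ and real $x$, with $\binom{x}{j}=\frac{x(x-1)\cdots(x-j+1)}{j!}$ for integers $j\ge0$ (and $\binom{x}{j}=0$ for $j<0$), define \[\varphi(x)=\left(\binom{n-1}{k-1}+\binom{n-2}{k-1}\right)\left(\binom{n-2}{\ell-2}+\binom{x}{n-\ell-1}\right)-\binom{n-2}{\ell-2}\binom{x}{k-1},\] and \[\Gamma=\max\left\{\left(\binom{n-1}{k-1}+\binom{n-2}{k-1}\right)\binom{n-2}{\ell-2},\ \left(\binom{n-1}{k-1}+1\right)\left(\binom{n-1}{\ell-1}-\binom{n-k-1}{\ell-1}\right)\right\}.\] -}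

module Defs where

open import Data.Nat using (ℕ; _∸_)
open import Data.Nat.Combinatorics using (_C_)
open import Data.Integer using (ℤ; +_; _+_; _-_; _*_; _⊔_)

-- For natural x the generalized binomial x(x-1)...(x-j+1)/j! equals the
-- usual one (0 when j > x); all lower indices used below are ≥ 0 under the
-- hypotheses, so ∸ never truncates there.
bin : ℕ → ℕ → ℤ
bin x j = + (x C j)

φ : ℕ → ℕ → ℕ → ℕ → ℤ
φ n k ℓ x =
  (bin (n ∸ 1) (k ∸ 1) + bin (n ∸ 2) (k ∸ 1))
    * (bin (n ∸ 2) (ℓ ∸ 2) + bin x (n ∸ ℓ ∸ 1))
  - bin (n ∸ 2) (ℓ ∸ 2) * bin x (k ∸ 1)

Γ : ℕ → ℕ → ℕ → ℤ
Γ n k ℓ =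
  ((bin (n ∸ 1) (k ∸ 1) + bin (n ∸ 2) (k ∸ 1)) * bin (n ∸ 2) (ℓ ∸ 2))
  ⊔ ((bin (n ∸ 1) (k ∸ 1) + + 1)
      * (bin (n ∸ 1) (ℓ ∸ 1) - bin (n ∸ k ∸ 1) (ℓ ∸ 1)))

{-# OPTIONS --safe #-}
-- Put m = n - 4, a = k - 1 and b = ℓ - 2.  Since φ(m) = A (P + E) - P D with
-- A = C(m+3,a) + C(m+2,a), P = C(m+2,b), E = C(m,m+1-b), D = C(m,a), and Γ ≥ A P,
-- it suffices to show A E < P D.  For b = 0 this holds because E = 0.  Otherwise
-- E = C(m,c) with c = b - 1, and ℓ² ≤ n gives 5c + 4 ≤ m.  Each ratio
-- C(N+1,a) / C(N,a) = (N+1) / (N+1-a) is then at most 5/4, so A ≤ 4 D, while the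
-- absorption identity (c+1) C(m+2,c+1) = (m+2) C(m+1,c) gives P > 4 E.
module Submission where

open import Defs
open import Data.Nat using (ℕ; _∸_; _<_; _≤_; _*_; zero; suc; _+_; _^_; _>_; z≤n; s≤s; >-nonZero)
open import Data.Integer using () renaming (_<_ to _<ℤ_)
open import Data.Nat.Properties
open import Data.Nat.Combinatorics using (_C_; nCk+nC[k+1]≡[n+1]C[k+1]; nCk≡nC[n∸k]; nC1≡n)
open import Data.Nat.Combinatorics.Specification using (k>n⇒nCk≡0)
open import Data.Nat.Tactic.RingSolver using (solve-∀)
open import Algebra.Properties.CommutativeSemigroup *-commutativeSemigroup using (x∙yz≈y∙xz; x∙yz≈yx∙z; xy∙z≈y∙xz)
open import Data.Product using (_,_)
open import Relation.Binary.PropositionalEquality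
import Data.Integer as ℤ
import Data.Integer.Properties as ℤ
import Data.Integer.Tactic.RingSolver as ℤ

[k+1]*[n+1]C[k+1]≡[n+1]*nCk : ∀ n k → suc k * (suc n C suc k) ≡ suc n * (n C k)
[k+1]*[n+1]C[k+1]≡[n+1]*nCk zero    zero    = refl
[k+1]*[n+1]C[k+1]≡[n+1]*nCk zero    (suc k) = *-zeroʳ (2 + k)
[k+1]*[n+1]C[k+1]≡[n+1]*nCk (suc n) zero    =
  trans (+-identityʳ ((2 + n) C 1)) (trans (nC1≡n (2 + n)) (sym (*-identityʳ (2 + n))))
[k+1]*[n+1]C[k+1]≡[n+1]*nCk (suc n) (suc k) = begin
  (2 + k) * ((2 + n) C (2 + k))    ≡⟨ cong ((2 + k) *_) (nCk+nC[k+1]≡[n+1]C[k+1] (suc n) (suc k)) ⟨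
  (2 + k) * (X + Y)                ≡⟨ regroup k X Y ⟩
  X + ((1 + k) * X + (2 + k) * Y)  ≡⟨ cong₂ (λ u v → X + (u + v)) ([k+1]*[n+1]C[k+1]≡[n+1]*nCk n k)
                                                                   ([k+1]*[n+1]C[k+1]≡[n+1]*nCk n (suc k)) ⟩
  X + ((1 + n) * p + (1 + n) * q)  ≡⟨ cong (X +_) (*-distribˡ-+ (1 + n) p q) ⟨
  X + (1 + n) * (p + q)            ≡⟨ cong (λ t → X + (1 + n) * t) (nCk+nC[k+1]≡[n+1]C[k+1] n k) ⟩
  (2 + n) * X                      ∎
  where
  open ≡-Reasoning
  X = (1 + n) C (1 + k)
  Y = (1 + n) C (2 + k)
  p = n C k
  q = n C (1 + k)
  regroup : ∀ k X Y → (2 + k) * (X + Y) ≡ X + ((1 + k) * X + (2 + k) * Y)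
  regroup = solve-∀

nCk≤[n+1]Ck : ∀ n k → n C k ≤ suc n C k
nCk≤[n+1]Ck n zero    = ≤-refl
nCk≤[n+1]Ck n (suc k) = ≤-trans (m≤n+m (n C suc k) (n C k)) (≤-reflexive (nCk+nC[k+1]≡[n+1]C[k+1] n k))

k≤n⇒nCk>0 : ∀ {n k} → k ≤ n → n C k > 0
k≤n⇒nCk>0 {n}     {zero}  _         = s≤s z≤n
k≤n⇒nCk>0 {suc n} {suc k} (s≤s k≤n) =
  ≤-trans (k≤n⇒nCk>0 k≤n) (≤-trans (m≤m+n (n C k) _) (≤-reflexive (nCk+nC[k+1]≡[n+1]C[k+1] n k)))

-- C(n+1,k) / C(n,k) = (n+1) / (n+1-k), which is at most (r+1) / r iff (r+1) k ≤ n+1.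
r*[n+1]Ck≤[r+1]*nCk : ∀ r n k → suc r * k ≤ suc n → r * (suc n C k) ≤ suc r * (n C k)
r*[n+1]Ck≤[r+1]*nCk r n zero    _ = *-monoˡ-≤ 1 (n≤1+n r)
r*[n+1]Ck≤[r+1]*nCk r n (suc k) h = begin
  r * (suc n C suc k)  ≡⟨ cong (r *_) (nCk+nC[k+1]≡[n+1]C[k+1] n k) ⟨
  r * (p + q)          ≡⟨ *-distribˡ-+ r p q ⟩
  r * p + r * q        ≤⟨ +-monoˡ-≤ (r * q) r*p≤q ⟩
  suc r * q            ∎
  where
  open ≤-Reasoning
  p = n C k
  q = n C suc k
  ratio : suc k * p + suc k * q ≡ suc n * p
  ratio = trans (sym (*-distribˡ-+ (suc k) p q))
                (trans (cong (suc k *_) (nCk+nC[k+1]≡[n+1]C[k+1] n k)) ([k+1]*[n+1]C[k+1]≡[n+1]*nCk n k))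
  expand : ∀ r k p → (suc r * suc k) * p ≡ suc k * p + suc k * (r * p)
  expand = solve-∀
  r*p≤q : r * p ≤ q
  r*p≤q = *-cancelˡ-≤ (suc k) (+-cancelˡ-≤ (suc k * p) _ _ (begin
    suc k * p + suc k * (r * p)  ≡⟨ expand r k p ⟨
    (suc r * suc k) * p          ≤⟨ *-monoˡ-≤ p h ⟩
    suc n * p                    ≡⟨ ratio ⟨
    suc k * p + suc k * q        ∎))

r^j*[j+n]Ck≤[r+1]^j*nCk : ∀ r j n k → suc r * k ≤ suc n → r ^ j * ((j + n) C k) ≤ suc r ^ j * (n C k)
r^j*[j+n]Ck≤[r+1]^j*nCk r zero    n k _ = ≤-refl
r^j*[j+n]Ck≤[r+1]^j*nCk r (suc j) n k h = begin
  (r * r ^ j) * (suc (j + n) C k)      ≡⟨ *-assoc r (r ^ j) _ ⟩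
  r * (r ^ j * (suc (j + n) C k))      ≡⟨ x∙yz≈y∙xz r (r ^ j) _ ⟩
  r ^ j * (r * (suc (j + n) C k))      ≤⟨ *-monoʳ-≤ (r ^ j) (r*[n+1]Ck≤[r+1]*nCk r (j + n) k h′) ⟩
  r ^ j * (suc r * ((j + n) C k))      ≡⟨ x∙yz≈y∙xz (r ^ j) (suc r) _ ⟩
  suc r * (r ^ j * ((j + n) C k))      ≤⟨ *-monoʳ-≤ (suc r) (r^j*[j+n]Ck≤[r+1]^j*nCk r j n k h) ⟩
  suc r * (suc r ^ j * (n C k))        ≡⟨ *-assoc (suc r) (suc r ^ j) (n C k) ⟨
  (suc r * suc r ^ j) * (n C k)        ∎
  where
  open ≤-Reasoning
  h′ : suc r * k ≤ suc (j + n)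
  h′ = ≤-trans h (s≤s (m≤n+m n j))

r*nCk<[n+1]C[k+1] : ∀ r {n k} → k ≤ n → r * suc k < suc n → r * (n C k) < suc n C suc k
r*nCk<[n+1]C[k+1] r {n} {k} k≤n h = *-cancelˡ-< (suc k) _ _ (begin-strict
  suc k * (r * (n C k))      ≡⟨ x∙yz≈yx∙z (suc k) r (n C k) ⟩
  (r * suc k) * (n C k)      <⟨ *-monoˡ-< (n C k) {{>-nonZero (k≤n⇒nCk>0 k≤n)}} h ⟩
  suc n * (n C k)            ≡⟨ [k+1]*[n+1]C[k+1]≡[n+1]*nCk n k ⟨
  suc k * (suc n C suc k)    ∎)
  where open ≤-Reasoning

[3+m]Ca+[2+m]Ca≤4*mCa : ∀ m a → 5 * a ≤ suc m → (3 + m) C a + (2 + m) C a ≤ 4 * (m C a)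
[3+m]Ca+[2+m]Ca≤4*mCa m a h = begin
  (3 + m) C a + (2 + m) C a  ≤⟨ +-monoʳ-≤ ((3 + m) C a) (nCk≤[n+1]Ck (2 + m) a) ⟩
  (3 + m) C a + (3 + m) C a  ≤⟨ +-mono-≤ [3+m]Ca≤2*mCa [3+m]Ca≤2*mCa ⟩
  2 * (m C a) + 2 * (m C a)  ≡⟨ *-distribʳ-+ (m C a) 2 2 ⟨
  4 * (m C a)                ∎
  where
  open ≤-Reasoning
  -- (5/4)³ < 2
  [3+m]Ca≤2*mCa : (3 + m) C a ≤ 2 * (m C a)
  [3+m]Ca≤2*mCa = *-cancelˡ-≤ 64 (begin
    64 * ((3 + m) C a)   ≤⟨ r^j*[j+n]Ck≤[r+1]^j*nCk 4 3 m a h ⟩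
    125 * (m C a)        ≤⟨ *-monoˡ-≤ (m C a) (m≤m+n 125 3) ⟩
    128 * (m C a)        ≡⟨ *-assoc 64 2 (m C a) ⟩
    64 * (2 * (m C a))   ∎)

[[3+m]Ca+[2+m]Ca]*mCc<[2+m]C[c+1]*mCa : ∀ m a c → a ≤ suc c → 5 * c + 4 ≤ m →
  ((3 + m) C a + (2 + m) C a) * (m C c) < ((2 + m) C suc c) * (m C a)
[[3+m]Ca+[2+m]Ca]*mCc<[2+m]C[c+1]*mCa m a c a≤c+1 5c+4≤m = begin-strict
  ((3 + m) C a + (2 + m) C a) * (m C c)  ≤⟨ *-monoˡ-≤ (m C c) ([3+m]Ca+[2+m]Ca≤4*mCa m a 5a≤1+m) ⟩
  4 * (m C a) * (m C c)                  ≡⟨ xy∙z≈y∙xz 4 (m C a) (m C c) ⟩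
  (m C a) * (4 * (m C c))                <⟨ *-monoʳ-< (m C a) {{>-nonZero (k≤n⇒nCk>0 a≤m)}} 4*mCc<[2+m]C[c+1] ⟩
  (m C a) * ((2 + m) C suc c)            ≡⟨ *-comm (m C a) _ ⟩
  ((2 + m) C suc c) * (m C a)            ∎
  where
  open ≤-Reasoning
  c<m : c < m
  c<m = m+n≤o⇒m≤o (suc c) (≤-trans (≤-reflexive (split₁ c)) 5c+4≤m)
    where split₁ : ∀ c → suc c + (4 * c + 3) ≡ 5 * c + 4
          split₁ = solve-∀
  a≤m : a ≤ m
  a≤m = ≤-trans a≤c+1 c<m
  5a≤1+m : 5 * a ≤ suc m
  5a≤1+m = ≤-trans (*-monoʳ-≤ 5 a≤c+1) (≤-trans (≤-reflexive (split₂ c)) (s≤s 5c+4≤m))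
    where split₂ : ∀ c → 5 * suc c ≡ suc (5 * c + 4)
          split₂ = solve-∀
  4[c+1]<2+m : 4 * suc c < 2 + m
  4[c+1]<2+m = m+n≤o⇒m≤o (suc (4 * suc c)) (≤-trans (≤-reflexive (split₃ c)) (+-monoʳ-≤ 2 5c+4≤m))
    where split₃ : ∀ c → suc (4 * suc c) + (c + 1) ≡ 2 + (5 * c + 4)
          split₃ = solve-∀
  4*mCc<[2+m]C[c+1] : 4 * (m C c) < (2 + m) C suc c
  4*mCc<[2+m]C[c+1] = ≤-<-trans (*-monoʳ-≤ 4 (nCk≤[n+1]Ck m c))
                                (r*nCk<[n+1]C[k+1] 4 (m<n⇒m≤1+n c<m) 4[c+1]<2+m)

[[3+m]Ca+[2+m]Ca]*mC[m+2∸b∸1]<[2+m]Cb*mCa : ∀ m a b → a ≤ b → (2 + b) * (2 + b) ≤ 4 + m →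
  ((3 + m) C a + (2 + m) C a) * (m C (2 + m ∸ b ∸ 1)) < ((2 + m) C b) * (m C a)
[[3+m]Ca+[2+m]Ca]*mC[m+2∸b∸1]<[2+m]Cb*mCa m zero zero z≤n _ =
  subst (λ x → 2 * x < 1) (sym (k>n⇒nCk≡0 (n<1+n m))) (s≤s z≤n)
[[3+m]Ca+[2+m]Ca]*mC[m+2∸b∸1]<[2+m]Cb*mCa m a (suc c) a≤c+1 [3+c]²≤4+m =
  subst (λ x → ((3 + m) C a + (2 + m) C a) * x < ((2 + m) C suc c) * (m C a)) mCc≡mC[m+1∸c∸1]
        ([[3+m]Ca+[2+m]Ca]*mCc<[2+m]C[c+1]*mCa m a c a≤c+1 5c+4≤m)
  where
  split : ∀ c → (3 + c) * (3 + c) ≡ (4 + (5 * c + 4)) + (c * c + c + 1)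
  split = solve-∀
  5c+4≤m : 5 * c + 4 ≤ m
  5c+4≤m = +-cancelˡ-≤ 4 _ _ (m+n≤o⇒m≤o (4 + (5 * c + 4)) (≤-trans (≤-reflexive (sym (split c))) [3+c]²≤4+m))
  c≤m : c ≤ m
  c≤m = ≤-trans (m≤n*m c 5) (≤-trans (m≤m+n (5 * c) 4) 5c+4≤m)
  mCc≡mC[m+1∸c∸1] : m C c ≡ m C (suc m ∸ c ∸ 1)
  mCc≡mC[m+1∸c∸1] = trans (nCk≡nC[n∸k] c≤m) (cong (λ i → m C (i ∸ 1)) (sym (+-∸-assoc 1 c≤m)))

binomial-inequality : ∀ n k ℓ → 0 < k → k < ℓ → ℓ * ℓ ≤ n →
  ((n ∸ 1) C (k ∸ 1) + (n ∸ 2) C (k ∸ 1)) * ((n ∸ 4) C (n ∸ ℓ ∸ 1)) < ((n ∸ 2) C (ℓ ∸ 2)) * ((n ∸ 4) C (k ∸ 1))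
binomial-inequality n (suc a) (suc (suc b)) (s≤s z≤n) (s≤s (s≤s a≤b)) ℓ²≤n
  with m≤n⇒∃[o]m+o≡n (≤-trans (*-mono-≤ {2} {2 + b} {2} {2 + b} (s≤s (s≤s z≤n)) (s≤s (s≤s z≤n))) ℓ²≤n)
... | m , refl = [[3+m]Ca+[2+m]Ca]*mC[m+2∸b∸1]<[2+m]Cb*mCa m a b a≤b ℓ²≤n

a*e<p*d⇒a*[p+e]-p*d<a*p : ∀ a p e d → a ℤ.* e <ℤ p ℤ.* d → a ℤ.* (p ℤ.+ e) ℤ.- p ℤ.* d <ℤ a ℤ.* p
a*e<p*d⇒a*[p+e]-p*d<a*p a p e d a*e<p*d = begin-strict
  a ℤ.* (p ℤ.+ e) ℤ.- p ℤ.* d          ≡⟨ regroup₁ a p e d ⟩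
  a ℤ.* e ℤ.+ (a ℤ.* p ℤ.- p ℤ.* d)    <⟨ ℤ.+-monoˡ-< (a ℤ.* p ℤ.- p ℤ.* d) a*e<p*d ⟩
  p ℤ.* d ℤ.+ (a ℤ.* p ℤ.- p ℤ.* d)    ≡⟨ regroup₂ a p d ⟩
  a ℤ.* p                              ∎
  where
  open ℤ.≤-Reasoning
  regroup₁ : ∀ a p e d → a ℤ.* (p ℤ.+ e) ℤ.- p ℤ.* d ≡ a ℤ.* e ℤ.+ (a ℤ.* p ℤ.- p ℤ.* d)
  regroup₁ = ℤ.solve-∀
  regroup₂ : ∀ a p d → p ℤ.* d ℤ.+ (a ℤ.* p ℤ.- p ℤ.* d) ≡ a ℤ.* p
  regroup₂ = ℤ.solve-∀

lemma4p2 : (n k ℓ : ℕ) → 0 < k → k < ℓ → ℓ < ℓ * ℓ → ℓ * ℓ ≤ n →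
    φ n k ℓ (n ∸ 4) <ℤ Γ n k ℓ
lemma4p2 n k ℓ 0<k k<ℓ _ ℓ²≤n =
  ℤ.<-≤-trans (a*e<p*d⇒a*[p+e]-p*d<a*p (ℤ.+ X ℤ.+ ℤ.+ Y) _ _ _ A*E<P*D)
              (ℤ.i≤i⊔j _ _)
  where
  X = (n ∸ 1) C (k ∸ 1)
  Y = (n ∸ 2) C (k ∸ 1)
  P = (n ∸ 2) C (ℓ ∸ 2)
  E = (n ∸ 4) C (n ∸ ℓ ∸ 1)
  D = (n ∸ 4) C (k ∸ 1)
  A*E<P*D : (ℤ.+ X ℤ.+ ℤ.+ Y) ℤ.* ℤ.+ E <ℤ ℤ.+ P ℤ.* ℤ.+ D
  A*E<P*D = subst₂ _<ℤ_ (trans (ℤ.pos-* (X + Y) E) (cong (ℤ._* ℤ.+ E) (ℤ.pos-+ X Y))) (ℤ.pos-* P D)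
                   (ℤ.+<+ (binomial-inequality n k ℓ 0<k k<ℓ ℓ²≤n))
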